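{- Let $h_1,h_2,h_3,h_4\in\mathbb{N}$ and $v=h_1h_2h_3h_4+1$. In $\mathbb{Z}_v$ let $$A=\bigcup_{i=0}^{h_3-1}\{ih_1h_2+\alpha: 0\le\alpha\le h_1-1\},\qquad B=\bigcup_{i=0}^{h_4-1}\{ih_1h_2h_3+h_1h_2(h_3-1)+\beta h_1: 1\le\beta\le h_2\}.$$ Then $\{A,B\}$ is a classical $(v,2;h_1h_3,h_2h_4;1,1)$-GSEDF in $\mathbb{Z}_v$.
   Context: For subsets $A,B$ of an additively written group $G$, $\Delta(A,B)$ denotes the multiset $\{a-b:a\in A,b\in B\}$ (one entry per pair). For a set $S$ and $\lambda\in\mathbb{N}$, $\lambda S$ is the multiset of $\lambda$ copies of $S$. For a group $G$ of order $v$, a classical $(v,m;k_1,\dots,k_m;\lambda_1,\dots,\lambda_m)$-GSEDF is a family of pairwise disjoint sets $A_1,\dots,A_m$ in $G$ with $|A_i|=k_i$ such that for each $i$, the multiset union $\bigcup_{j\ne i}\Delta(A_i,A_j)$ equals $\lambda_i(G\setminus\{0\})$. -}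

module Defs where

open import Data.Nat using (ℕ; zero; suc; _+_; _*_; _∸_; NonZero)
open import Data.Nat.DivMod using (_mod_)
open import Data.Fin using (Fin; toℕ; _≟_)
open import Data.Fin.Base using () renaming (zero to fz; suc to fs)
open import Data.List using (List; []; _∷_; map; concat; concatMap; replicate; upTo; allFin; length; filter; cartesianProductWith)
open import Data.List.Relation.Unary.Unique.Propositional using (Unique)
open import Data.List.Membership.Propositional using (_∈_)
open import Data.List.Relation.Binary.Permutation.Propositional using (_↭_)
open import Data.Product using (_×_)
open import Data.Empty using (⊥)
open import Relation.Nullary using (¬_; ¬?)
open import Relation.Binary.PropositionalEquality using (_≡_)

[_]_ : ℕ → (v : ℕ) .{{_ : NonZero v}} → Fin v
[ n ] v = n mod v

sub : {v : ℕ} .{{_ : NonZero v}} → Fin v → Fin v → Fin v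
sub {v} a b = [ toℕ a + (v ∸ toℕ b) ] v

Δ : {v : ℕ} .{{_ : NonZero v}} → List (Fin v) → List (Fin v) → List (Fin v)
Δ A B = cartesianProductWith sub A B

nonzero : (v : ℕ) → List (Fin v)
nonzero v = filter (λ x → ¬? (toℕ x Data.Nat.≟ 0)) (allFin v)

copies : {A : Set} → ℕ → List A → List A
copies l S = concat (replicate l S)

ΔOthers : {v m : ℕ} .{{_ : NonZero v}} → (Fin m → List (Fin v)) → Fin m → List (Fin v)
ΔOthers {m = m} A i = concatMap (λ j → Δ (A i) (A j)) (filter (λ j → ¬? (j ≟ i)) (allFin m))

-- Classical (v, m; k_1..k_m; λ_1..λ_m)-GSEDF in Z_v.
-- Sets are represented as duplicate-free lists; multiset equality is _↭_.
record IsGSEDF (v m : ℕ) .{{_ : NonZero v}} (A : Fin m → List (Fin v))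
               (k : Fin m → ℕ) (λs : Fin m → ℕ) : Set where
  field
    isSet    : ∀ i → Unique (A i)
    disjoint : ∀ i j → ¬ (i ≡ j) → ∀ x → x ∈ A i → x ∈ A j → ⊥
    size     : ∀ i → length (A i) ≡ k i
    diffs    : ∀ i → ΔOthers A i ↭ copies (λs i) (nonzero v)

pair : {X : Set} → X → X → Fin 2 → X
pair x y fz = x
pair x y (fs fz) = y

setA : (h1 h2 h3 h4 : ℕ) → List (Fin (suc (h1 * h2 * h3 * h4)))
setA h1 h2 h3 h4 =
  concatMap (λ i → map (λ α → [ i * h1 * h2 + α ] (suc (h1 * h2 * h3 * h4))) (upTo h1)) (upTo h3)

-- β ranges over 1..h2, i.e. β = b + 1 with b ∈ upTo h2
setB : (h1 h2 h3 h4 : ℕ) → List (Fin (suc (h1 * h2 * h3 * h4)))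
setB h1 h2 h3 h4 =
  concatMap (λ i → map (λ b → [ i * h1 * h2 * h3 + h1 * h2 * (h3 ∸ 1) + suc b * h1 ] (suc (h1 * h2 * h3 * h4))) (upTo h2)) (upTo h4)

{-# OPTIONS --safe #-}
module Submission where

-- Write a = i h1 h2 + α for the elements of A and b = j h1 h2 h3 + h1 h2 (h3 − 1) + β h1
-- for those of B, all below v = h1 h2 h3 h4 + 1.  Then b − a − 1 is the number whose digits
-- in the mixed radix (h1, h2, h3, h4) are h1 − 1 − α, β − 1, h3 − 1 − i and j, and as the
-- indices range over their boxes these digit strings are exactly those of 0, …, v − 2.
-- So (a, b) ↦ b − a is a bijection A × B → Z_v ∖ {0}, and so is (a, b) ↦ a − b.  As both
-- sides are duplicate-free lists, equal membership already makes them permutations.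

open import Defs
open import Data.Nat using (ℕ; zero; suc; _+_; _*_; _∸_; _<_; _≤_; z<s; s≤s; s≤s⁻¹; _≟_; NonZero; >-nonZero⁻¹)
open import Data.Nat.Properties
open import Data.Nat.DivMod using (_%_; _/_; m%n<n; m<n⇒m%n≡m; [m+n]%n≡m%n; [m+kn]%n≡m%n; m≡m%n+[m/n]*n; m<n*o⇒m/o<n)
open import Data.Nat.Tactic.RingSolver using (solve-∀)
open import Data.Fin using (Fin; toℕ) renaming (zero to fz; suc to fs)
open import Data.Fin.Properties using (toℕ-fromℕ<; toℕ<n; toℕ-injective)
open import Data.List using (List; []; _∷_; map; concatMap; _++_; cartesianProductWith; upTo; allFin; length)
open import Data.List.Properties using (length-map; length-++; length-upTo)
open import Data.List.Relation.Unary.All as All using ()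
open import Data.List.Relation.Unary.AllPairs using ([]; _∷_)
open import Data.List.Relation.Unary.Any using (here; there)
open import Data.List.Relation.Unary.Unique.Propositional using (Unique)
open import Data.List.Relation.Unary.Unique.Propositional.Properties using (++⁺; upTo⁺; filter⁺; allFin⁺)
open import Data.List.Membership.Propositional using (_∈_)
open import Data.List.Membership.Propositional.Properties
  using (∈-map⁻; ∈-cartesianProductWith⁺; ∈-cartesianProductWith⁻; ∈-upTo⁺; ∈-upTo⁻; ∈-filter⁺; ∈-filter⁻; ∈-allFin)
open import Data.List.Membership.Propositional.Properties.WithK using (unique∧set⇒bag)
open import Data.List.Relation.Binary.BagAndSetEquality using (∼bag⇒↭)
open import Data.List.Relation.Binary.Permutation.Propositional using (_↭_)
open import Data.List.Relation.Binary.Permutation.Propositional.Properties using (++⁺ʳ)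
open import Data.Empty using (⊥)
open import Data.Product using (_×_; _,_; proj₁; proj₂; ∃-syntax)
open import Function.Base using (_∘_)
open import Function.Bundles using (mk⇔)
open import Relation.Nullary using (¬_; ¬?; contradiction)
open import Relation.Binary.PropositionalEquality
  using (_≡_; _≢_; refl; sym; trans; cong; cong₂; subst; module ≡-Reasoning)

module _ {A B C : Set} (f : A → B → C) where

  concatMap-map≡cartesianProductWith : ∀ xs ys →
    concatMap (λ x → map (f x) ys) xs ≡ cartesianProductWith f xs ys
  concatMap-map≡cartesianProductWith []       ys = refl
  concatMap-map≡cartesianProductWith (x ∷ xs) ys =
    cong (map (f x) ys ++_) (concatMap-map≡cartesianProductWith xs ys)

  length-cartesianProductWith : ∀ xs ys →
    length (cartesianProductWith f xs ys) ≡ length xs * length ys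
  length-cartesianProductWith []       ys = refl
  length-cartesianProductWith (x ∷ xs) ys = begin
    length (map (f x) ys ++ cartesianProductWith f xs ys)       ≡⟨ length-++ (map (f x) ys) ⟩
    length (map (f x) ys) + length (cartesianProductWith f xs ys)
      ≡⟨ cong₂ _+_ (length-map (f x) ys) (length-cartesianProductWith xs ys) ⟩
    length ys + length xs * length ys                           ∎
    where open ≡-Reasoning

map⁺-on : ∀ {A B : Set} (f : A → B) {xs} → Unique xs →
  (∀ {x y} → x ∈ xs → y ∈ xs → f x ≡ f y → x ≡ y) → Unique (map f xs)
map⁺-on f []          f-inj = []
map⁺-on f (x∉ ∷ xs!) f-inj =
  All.tabulate (λ fy∈ fx≡fy → let y , y∈ , fy≡ = ∈-map⁻ f fy∈ in
                 All.lookup x∉ y∈ (f-inj (here refl) (there y∈) (trans fx≡fy fy≡)))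
  ∷ map⁺-on f xs! (λ x∈ y∈ → f-inj (there x∈) (there y∈))

-- The library's cartesianProductWith⁺ for Unique needs f injective everywhere; the
-- embeddings of index pairs into Z_v used below are injective only on the listed ranges.
cartesianProductWith⁺-on : ∀ {A B C : Set} (f : A → B → C) {xs ys} → Unique xs → Unique ys →
  (∀ {w x y z} → w ∈ xs → x ∈ xs → y ∈ ys → z ∈ ys → f w y ≡ f x z → w ≡ x × y ≡ z) →
  Unique (cartesianProductWith f xs ys)
cartesianProductWith⁺-on f []                  ys! f-inj = []
cartesianProductWith⁺-on f {x ∷ xs} {ys} (x∉ ∷ xs!) ys! f-inj =
  ++⁺ (map⁺-on (f x) ys! λ y∈ z∈ → proj₂ ∘ f-inj (here refl) (here refl) y∈ z∈)
      (cartesianProductWith⁺-on f xs! ys! λ w∈ x∈ → f-inj (there w∈) (there x∈))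
      disjoint
  where
  disjoint : ∀ {z} → ¬ (z ∈ map (f x) ys × z ∈ cartesianProductWith f xs ys)
  disjoint (z∈ , z∈′) with ∈-map⁻ (f x) z∈ | ∈-cartesianProductWith⁻ f xs ys z∈′
  ... | y , y∈ , z≡ | w , y′ , w∈ , y′∈ , z≡′ =
    All.lookup x∉ w∈ (proj₁ (f-inj (here refl) (there w∈) y∈ y′∈ (trans (sym z≡) z≡′)))

module _ {C : Set} (f : ℕ → ℕ → C) where

  ∈-cartesianProductWith-upTo⁻ : ∀ {m n z} → z ∈ cartesianProductWith f (upTo m) (upTo n) →
    ∃[ i ] ∃[ k ] i < m × k < n × z ≡ f i k
  ∈-cartesianProductWith-upTo⁻ {m} {n} z∈ with ∈-cartesianProductWith⁻ f (upTo m) (upTo n) z∈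
  ... | i , k , i∈ , k∈ , z≡ = i , k , ∈-upTo⁻ i∈ , ∈-upTo⁻ k∈ , z≡

  ∈-cartesianProductWith-upTo⁺ : ∀ {m n i k} → i < m → k < n →
    f i k ∈ cartesianProductWith f (upTo m) (upTo n)
  ∈-cartesianProductWith-upTo⁺ i<m k<n = ∈-cartesianProductWith⁺ f (∈-upTo⁺ i<m) (∈-upTo⁺ k<n)

  length-cartesianProductWith-upTo : ∀ m n → length (cartesianProductWith f (upTo m) (upTo n)) ≡ m * n
  length-cartesianProductWith-upTo m n = trans (length-cartesianProductWith f (upTo m) (upTo n))
    (cong₂ _*_ (length-upTo m) (length-upTo n))

  Unique-cartesianProductWith-upTo : ∀ {m n} →
    (∀ {i i′ k k′} → i < m → i′ < m → k < n → k′ < n → f i k ≡ f i′ k′ → i ≡ i′ × k ≡ k′) →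
    Unique (cartesianProductWith f (upTo m) (upTo n))
  Unique-cartesianProductWith-upTo {m} {n} f-inj = cartesianProductWith⁺-on f (upTo⁺ m) (upTo⁺ n)
    λ i∈ i′∈ k∈ k′∈ → f-inj (∈-upTo⁻ i∈) (∈-upTo⁻ i′∈) (∈-upTo⁻ k∈) (∈-upTo⁻ k′∈)

∸-suc-< : ∀ {i h} → i < h → h ∸ suc i < h
∸-suc-< {i} {suc h} _ = s≤s (m∸n≤m h i)

∸-suc-involutive : ∀ {i h} → i < h → h ∸ suc (h ∸ suc i) ≡ i
∸-suc-involutive (s≤s i≤h) = m∸[m∸n]≡n i≤h

radix-< : ∀ {q d k r} → k < q → r < d → r + k * d < q * d
radix-< {q} {d} {k} {r} k<q r<d = begin-strict
  r + k * d  <⟨ +-monoˡ-< (k * d) r<d ⟩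
  d + k * d  ≤⟨ *-monoˡ-≤ d k<q ⟩
  q * d      ∎
  where open ≤-Reasoning

radix-injective : ∀ {d k k′ r r′} .{{_ : NonZero d}} → r < d → r′ < d →
  r + k * d ≡ r′ + k′ * d → r ≡ r′ × k ≡ k′
radix-injective {d} {k} {k′} {r} {r′} r<d r′<d eq = r≡r′ , k≡k′
  where
  open ≡-Reasoning
  r≡r′ : r ≡ r′
  r≡r′ = begin
    r                ≡⟨ sym (m<n⇒m%n≡m r<d) ⟩
    r % d            ≡⟨ sym ([m+kn]%n≡m%n r k d) ⟩
    (r + k * d) % d  ≡⟨ cong (_% d) eq ⟩
    (r′ + k′ * d) % d ≡⟨ [m+kn]%n≡m%n r′ k′ d ⟩
    r′ % d           ≡⟨ m<n⇒m%n≡m r′<d ⟩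
    r′               ∎
  k≡k′ : k ≡ k′
  k≡k′ = *-cancelʳ-≡ k k′ d (+-cancelˡ-≡ r (k * d) (k′ * d) (trans eq (cong (_+ k′ * d) (sym r≡r′))))

radix-surjective : ∀ {q d x} .{{_ : NonZero d}} → x < q * d →
  ∃[ r ] ∃[ k ] r < d × k < q × r + k * d ≡ x
radix-surjective {q} {d} {x} x<qd =
  x % d , x / d , m%n<n x d , m<n*o⇒m/o<n x<qd , sym (m≡m%n+[m/n]*n x d)

toℕ-[] : ∀ {n m} → m < suc n → toℕ ([ m ] suc n) ≡ m
toℕ-[] m<1+n = trans (toℕ-fromℕ< _) (m<n⇒m%n≡m m<1+n)

toℕ-sub-above : ∀ {n d} {x y : Fin (suc n)} → toℕ y ≡ toℕ x + d → toℕ (sub y x) ≡ d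
toℕ-sub-above {n} {d} {x} {y} y≡x+d = begin
  toℕ (sub y x)                      ≡⟨ toℕ-fromℕ< _ ⟩
  (toℕ y + (suc n ∸ toℕ x)) % suc n  ≡⟨ cong (λ t → (t + (suc n ∸ toℕ x)) % suc n) y≡x+d ⟩
  (toℕ x + d + (suc n ∸ toℕ x)) % suc n
    ≡⟨ cong (_% suc n) (trans (cong (_+ (suc n ∸ toℕ x)) (+-comm (toℕ x) d)) (+-assoc d (toℕ x) _)) ⟩
  (d + (toℕ x + (suc n ∸ toℕ x))) % suc n
    ≡⟨ cong (λ t → (d + t) % suc n) (m+[n∸m]≡n (<⇒≤ (toℕ<n x))) ⟩
  (d + suc n) % suc n                ≡⟨ [m+n]%n≡m%n d (suc n) ⟩
  d % suc n                          ≡⟨ m<n⇒m%n≡m d<1+n ⟩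
  d                                  ∎
  where
  open ≡-Reasoning
  d<1+n : d < suc n
  d<1+n = ≤-<-trans (≤-trans (m≤n+m d (toℕ x)) (≤-reflexive (sym y≡x+d))) (toℕ<n y)

toℕ-sub-below : ∀ {n c} {x y : Fin (suc n)} → toℕ y ≡ toℕ x + suc c → toℕ (sub x y) ≡ n ∸ c
toℕ-sub-below {n} {c} {x} {y} y≡x+1+c = begin
  toℕ (sub x y)                                  ≡⟨ toℕ-fromℕ< _ ⟩
  (toℕ x + (suc n ∸ toℕ y)) % suc n
    ≡⟨ cong (λ t → (toℕ x + (suc n ∸ t)) % suc n) (trans y≡x+1+c (+-suc (toℕ x) c)) ⟩
  (toℕ x + (n ∸ (toℕ x + c))) % suc n            ≡⟨ cong (_% suc n) (sym (+-∸-assoc (toℕ x) x+c≤n)) ⟩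
  (toℕ x + n ∸ (toℕ x + c)) % suc n              ≡⟨ cong (_% suc n) ([m+n]∸[m+o]≡n∸o (toℕ x) n c) ⟩
  (n ∸ c) % suc n                                ≡⟨ m<n⇒m%n≡m (s≤s (m∸n≤m n c)) ⟩
  n ∸ c                                          ∎
  where
  open ≡-Reasoning
  x+c≤n : toℕ x + c ≤ n
  x+c≤n = <⇒≤ (s≤s⁻¹ (subst (_< suc n) (trans y≡x+1+c (+-suc (toℕ x) c)) (toℕ<n y)))

∈-nonzero⁺ : ∀ {v} {x : Fin v} → toℕ x ≢ 0 → x ∈ nonzero v
∈-nonzero⁺ {v} {x} x≢0 = ∈-filter⁺ (λ y → ¬? (toℕ y ≟ 0)) (∈-allFin x) x≢0

∈-nonzero⁻ : ∀ {v} {x : Fin v} → x ∈ nonzero v → toℕ x ≢ 0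
∈-nonzero⁻ {v} x∈ = proj₂ (∈-filter⁻ (λ y → ¬? (toℕ y ≟ 0)) {xs = allFin v} x∈)

↭-nonzero : ∀ {v} {zs : List (Fin v)} → Unique zs →
  (∀ {z} → z ∈ zs → toℕ z ≢ 0) → (∀ {z} → toℕ z ≢ 0 → z ∈ zs) → zs ↭ nonzero v
↭-nonzero {v} zs! nonzero⇐ nonzero⇒ =
  ∼bag⇒↭ (unique∧set⇒bag zs! (filter⁺ _ (allFin⁺ v)) (mk⇔ (∈-nonzero⁺ ∘ nonzero⇐) (nonzero⇒ ∘ ∈-nonzero⁻)))

toℕ≢0⇒≡suc : ∀ {n} {z : Fin (suc n)} → toℕ z ≢ 0 → ∃[ c ] c < n × toℕ z ≡ suc c
toℕ≢0⇒≡suc {z = z} z≢0 = go z≢0 (toℕ<n z)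
  where
  go : ∀ {m n} → m ≢ 0 → m < suc n → ∃[ c ] c < n × m ≡ suc c
  go {zero}  m≢0 _     = contradiction refl m≢0
  go {suc c} _   m<1+n = c , s≤s⁻¹ m<1+n , refl

-- With h1 = 1 + α + α′ and h3 = 1 + i + i′ the truncated h3 ∸ 1 disappears and what is left
-- is a semiring identity.
gap-identity : ∀ {h1 h3 i i′ α α′} h2 j β → h1 ≡ suc (α + α′) → h3 ≡ suc (i + i′) →
  j * h1 * h2 * h3 + h1 * h2 * (h3 ∸ 1) + suc β * h1
    ≡ (i * h1 * h2 + α) + suc (α′ + (β + (i′ + j * h3) * h2) * h1)
gap-identity {i = i} {i′} {α} {α′} h2 j β refl refl = identity h2 i i′ α α′ j β
  where
  identity : ∀ h2 i i′ α α′ j β → let h1 = suc (α + α′) ; h3 = suc (i + i′) in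
    j * h1 * h2 * h3 + h1 * h2 * (i + i′) + suc β * h1
      ≡ (i * h1 * h2 + α) + suc (α′ + (β + (i′ + j * h3) * h2) * h1)
  identity = solve-∀

module Construction (h1 h2 h3 h4 : ℕ)
  .{{_ : NonZero h1}} .{{_ : NonZero h2}} .{{_ : NonZero h3}} .{{_ : NonZero h4}} where

  0<h1 : 0 < h1
  0<h1 = >-nonZero⁻¹ h1

  0<h2 : 0 < h2
  0<h2 = >-nonZero⁻¹ h2

  0<h3 : 0 < h3
  0<h3 = >-nonZero⁻¹ h3

  0<h4 : 0 < h4
  0<h4 = >-nonZero⁻¹ h4

  n : ℕ
  n = h1 * h2 * h3 * h4

  a : ℕ → ℕ → ℕ
  a i α = i * h1 * h2 + α

  b : ℕ → ℕ → ℕ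
  b j β = j * h1 * h2 * h3 + h1 * h2 * (h3 ∸ 1) + suc β * h1

  δ : ℕ → ℕ → ℕ → ℕ → ℕ
  δ i α j β = (h1 ∸ suc α) + (β + ((h3 ∸ suc i) + j * h3) * h2) * h1

  n≡h4*h3*h2*h1 : n ≡ h4 * h3 * h2 * h1
  n≡h4*h3*h2*h1 = reverse h1 h2 h3 h4
    where
    reverse : ∀ p q r s → p * q * r * s ≡ s * r * q * p
    reverse = solve-∀

  δ< : ∀ {i α j β} → i < h3 → α < h1 → j < h4 → β < h2 → δ i α j β < n
  δ< {i} {α} {j} {β} i<h3 α<h1 j<h4 β<h2 = subst (δ i α j β <_) (sym n≡h4*h3*h2*h1)
    (radix-< (radix-< (radix-< j<h4 (∸-suc-< i<h3)) β<h2) (∸-suc-< α<h1))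

  δ-injective : ∀ {i α j β i′ α′ j′ β′} → i < h3 → α < h1 → β < h2 → i′ < h3 → α′ < h1 → β′ < h2 →
    δ i α j β ≡ δ i′ α′ j′ β′ → i ≡ i′ × α ≡ α′ × j ≡ j′ × β ≡ β′
  δ-injective i<h3 α<h1 β<h2 i′<h3 α′<h1 β′<h2 eq
    with radix-injective (∸-suc-< α<h1) (∸-suc-< α′<h1) eq
  ... | α-digits , eq₁ with radix-injective β<h2 β′<h2 eq₁
  ... | refl , eq₂ with radix-injective (∸-suc-< i<h3) (∸-suc-< i′<h3) eq₂
  ... | i-digits , j≡j′ =
    suc-injective (∸-cancelˡ-≡ i<h3 i′<h3 i-digits) ,
    suc-injective (∸-cancelˡ-≡ α<h1 α′<h1 α-digits) , j≡j′ , refl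

  δ-surjective : ∀ {c} → c < n →
    ∃[ i ] ∃[ α ] ∃[ j ] ∃[ β ] i < h3 × α < h1 × j < h4 × β < h2 × δ i α j β ≡ c
  δ-surjective {c} c<n with radix-surjective {h4 * h3 * h2} {h1} (subst (c <_) n≡h4*h3*h2*h1 c<n)
  ... | r₁ , _ , r₁<h1 , k₁< , refl with radix-surjective {h4 * h3} {h2} k₁<
  ... | β , _ , β<h2 , k₂< , refl with radix-surjective {h4} {h3} k₂<
  ... | r₃ , j , r₃<h3 , j<h4 , refl =
    h3 ∸ suc r₃ , h1 ∸ suc r₁ , j , β , ∸-suc-< r₃<h3 , ∸-suc-< r₁<h1 , j<h4 , β<h2 ,
    cong₂ (λ s t → t + (β + (s + j * h3) * h2) * h1) (∸-suc-involutive r₃<h3) (∸-suc-involutive r₁<h1)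

  b≡a+1+δ : ∀ {i α} j β → i < h3 → α < h1 → b j β ≡ a i α + suc (δ i α j β)
  b≡a+1+δ {i} {α} j β i<h3 α<h1 = gap-identity {i = i} {α = α} h2 j β (sym (m+[n∸m]≡n α<h1)) (sym (m+[n∸m]≡n i<h3))

  a-injective : ∀ {i α i′ α′} → α < h1 → α′ < h1 → a i α ≡ a i′ α′ → i ≡ i′ × α ≡ α′
  a-injective {i} {α} {i′} {α′} α<h1 α′<h1 eq =
    let α≡α′ , eq′ = radix-injective α<h1 α′<h1 (trans (sym (a≡ i α)) (trans eq (a≡ i′ α′)))
    in *-cancelʳ-≡ i i′ h2 eq′ , α≡α′
    where
    reorder : ∀ i p q α → i * p * q + α ≡ α + i * q * p
    reorder = solve-∀
    a≡ : ∀ i α → a i α ≡ α + i * h2 * h1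
    a≡ i α = reorder i h1 h2 α

  b-injective : ∀ {j β j′ β′} → β < h2 → β′ < h2 → b j β ≡ b j′ β′ → j ≡ j′ × β ≡ β′
  b-injective {j} {β} {j′} {β′} β<h2 β′<h2 eq =
    let _ , _ , j≡j′ , β≡β′ = δ-injective 0<h3 0<h1 β<h2 0<h3 0<h1 β′<h2 (suc-injective (begin
          suc (δ 0 0 j β)    ≡⟨ sym (b≡a+1+δ j β 0<h3 0<h1) ⟩
          b j β              ≡⟨ eq ⟩
          b j′ β′            ≡⟨ b≡a+1+δ j′ β′ 0<h3 0<h1 ⟩
          suc (δ 0 0 j′ β′)  ∎))
    in j≡j′ , β≡β′
    where open ≡-Reasoning

  a<b : ∀ {i α} j β → i < h3 → α < h1 → a i α < b j β
  a<b {i} {α} j β i<h3 α<h1 = subst (a i α <_) (sym (b≡a+1+δ j β i<h3 α<h1)) (m<m+n (a i α) z<s)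

  b≤n : ∀ {j β} → j < h4 → β < h2 → b j β ≤ n
  b≤n {j} {β} j<h4 β<h2 = ≤-trans (≤-reflexive (b≡a+1+δ j β 0<h3 0<h1)) (δ< 0<h3 0<h1 j<h4 β<h2)

  eA : ℕ → ℕ → Fin (suc n)
  eA i α = [ a i α ] suc n

  eB : ℕ → ℕ → Fin (suc n)
  eB j β = [ b j β ] suc n

  toℕ-eA : ∀ {i α} → i < h3 → α < h1 → toℕ (eA i α) ≡ a i α
  toℕ-eA i<h3 α<h1 = toℕ-[] (<-≤-trans (a<b 0 0 i<h3 α<h1) (m≤n⇒m≤1+n (b≤n 0<h4 0<h2)))

  toℕ-eB : ∀ {j β} → j < h4 → β < h2 → toℕ (eB j β) ≡ b j β
  toℕ-eB j<h4 β<h2 = toℕ-[] (s≤s (b≤n j<h4 β<h2))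

  toℕ-eB≡toℕ-eA+1+δ : ∀ {i α j β} → i < h3 → α < h1 → j < h4 → β < h2 →
    toℕ (eB j β) ≡ toℕ (eA i α) + suc (δ i α j β)
  toℕ-eB≡toℕ-eA+1+δ {i} {α} {j} {β} i<h3 α<h1 j<h4 β<h2 = begin
    toℕ (eB j β)                    ≡⟨ toℕ-eB j<h4 β<h2 ⟩
    b j β                           ≡⟨ b≡a+1+δ j β i<h3 α<h1 ⟩
    a i α + suc (δ i α j β)         ≡⟨ cong (_+ suc (δ i α j β)) (sym (toℕ-eA i<h3 α<h1)) ⟩
    toℕ (eA i α) + suc (δ i α j β)  ∎
    where open ≡-Reasoning

  A : List (Fin (suc n))
  A = setA h1 h2 h3 h4

  B : List (Fin (suc n))
  B = setB h1 h2 h3 h4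

  A≡ : A ≡ cartesianProductWith eA (upTo h3) (upTo h1)
  A≡ = concatMap-map≡cartesianProductWith eA (upTo h3) (upTo h1)

  B≡ : B ≡ cartesianProductWith eB (upTo h4) (upTo h2)
  B≡ = concatMap-map≡cartesianProductWith eB (upTo h4) (upTo h2)

  ∈A⁻ : ∀ {x} → x ∈ A → ∃[ i ] ∃[ α ] i < h3 × α < h1 × x ≡ eA i α
  ∈A⁻ {x} x∈A = ∈-cartesianProductWith-upTo⁻ eA (subst (x ∈_) A≡ x∈A)

  ∈B⁻ : ∀ {y} → y ∈ B → ∃[ j ] ∃[ β ] j < h4 × β < h2 × y ≡ eB j β
  ∈B⁻ {y} y∈B = ∈-cartesianProductWith-upTo⁻ eB (subst (y ∈_) B≡ y∈B)

  ∈A⁺ : ∀ {i α} → i < h3 → α < h1 → eA i α ∈ A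
  ∈A⁺ {i} {α} i<h3 α<h1 = subst (eA i α ∈_) (sym A≡) (∈-cartesianProductWith-upTo⁺ eA i<h3 α<h1)

  ∈B⁺ : ∀ {j β} → j < h4 → β < h2 → eB j β ∈ B
  ∈B⁺ {j} {β} j<h4 β<h2 = subst (eB j β ∈_) (sym B≡) (∈-cartesianProductWith-upTo⁺ eB j<h4 β<h2)

  eA-injective : ∀ {i i′ α α′} → i < h3 → i′ < h3 → α < h1 → α′ < h1 →
    eA i α ≡ eA i′ α′ → i ≡ i′ × α ≡ α′
  eA-injective {i} {i′} {α} {α′} i<h3 i′<h3 α<h1 α′<h1 eq = a-injective α<h1 α′<h1 (begin
    a i α            ≡⟨ sym (toℕ-eA i<h3 α<h1) ⟩
    toℕ (eA i α)     ≡⟨ cong toℕ eq ⟩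
    toℕ (eA i′ α′)   ≡⟨ toℕ-eA i′<h3 α′<h1 ⟩
    a i′ α′          ∎)
    where open ≡-Reasoning

  eB-injective : ∀ {j j′ β β′} → j < h4 → j′ < h4 → β < h2 → β′ < h2 →
    eB j β ≡ eB j′ β′ → j ≡ j′ × β ≡ β′
  eB-injective {j} {j′} {β} {β′} j<h4 j′<h4 β<h2 β′<h2 eq = b-injective β<h2 β′<h2 (begin
    b j β            ≡⟨ sym (toℕ-eB j<h4 β<h2) ⟩
    toℕ (eB j β)     ≡⟨ cong toℕ eq ⟩
    toℕ (eB j′ β′)   ≡⟨ toℕ-eB j′<h4 β′<h2 ⟩
    b j′ β′          ∎)
    where open ≡-Reasoning

  A-unique : Unique A
  A-unique = subst Unique (sym A≡) (Unique-cartesianProductWith-upTo eA eA-injective)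

  B-unique : Unique B
  B-unique = subst Unique (sym B≡) (Unique-cartesianProductWith-upTo eB eB-injective)

  length-A : length A ≡ h1 * h3
  length-A = trans (cong length A≡) (trans (length-cartesianProductWith-upTo eA h3 h1) (*-comm h3 h1))

  length-B : length B ≡ h2 * h4
  length-B = trans (cong length B≡) (trans (length-cartesianProductWith-upTo eB h4 h2) (*-comm h4 h2))

  A×B-gap : ∀ {x y} → x ∈ A → y ∈ B → ∃[ c ] c < n × toℕ y ≡ toℕ x + suc c
  A×B-gap x∈A y∈B with ∈A⁻ x∈A | ∈B⁻ y∈B
  ... | i , α , i<h3 , α<h1 , refl | j , β , j<h4 , β<h2 , refl =
    δ i α j β , δ< i<h3 α<h1 j<h4 β<h2 , toℕ-eB≡toℕ-eA+1+δ i<h3 α<h1 j<h4 β<h2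

  δ≡gap : ∀ {x y i α j β c} → i < h3 → α < h1 → j < h4 → β < h2 → x ≡ eA i α → y ≡ eB j β →
    toℕ y ≡ toℕ x + suc c → δ i α j β ≡ c
  δ≡gap {i = i} {α} i<h3 α<h1 j<h4 β<h2 refl refl gap = suc-injective (+-cancelˡ-≡ (toℕ (eA i α)) _ _
    (trans (sym (toℕ-eB≡toℕ-eA+1+δ i<h3 α<h1 j<h4 β<h2)) gap))

  gap-injective : ∀ {x x′ y y′ c c′} → x ∈ A → x′ ∈ A → y ∈ B → y′ ∈ B →
    toℕ y ≡ toℕ x + suc c → toℕ y′ ≡ toℕ x′ + suc c′ → c ≡ c′ → x ≡ x′ × y ≡ y′
  gap-injective {c = c} {c′} x∈A x′∈A y∈B y′∈B gap gap′ c≡c′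
    with ∈A⁻ x∈A | ∈A⁻ x′∈A | ∈B⁻ y∈B | ∈B⁻ y′∈B
  ... | i , α , i<h3 , α<h1 , x≡ | i′ , α′ , i′<h3 , α′<h1 , x′≡
      | j , β , j<h4 , β<h2 , y≡ | j′ , β′ , j′<h4 , β′<h2 , y′≡ =
    let i≡i′ , α≡α′ , j≡j′ , β≡β′ = δ-injective {j = j} {j′ = j′} i<h3 α<h1 β<h2 i′<h3 α′<h1 β′<h2 (begin
          δ i α j β      ≡⟨ δ≡gap i<h3 α<h1 j<h4 β<h2 x≡ y≡ gap ⟩
          c              ≡⟨ c≡c′ ⟩
          c′             ≡⟨ sym (δ≡gap i′<h3 α′<h1 j′<h4 β′<h2 x′≡ y′≡ gap′) ⟩
          δ i′ α′ j′ β′  ∎)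
    in trans x≡ (trans (cong₂ eA i≡i′ α≡α′) (sym x′≡)) , trans y≡ (trans (cong₂ eB j≡j′ β≡β′) (sym y′≡))
    where open ≡-Reasoning

  gap-surjective : ∀ {c} → c < n → ∃[ x ] ∃[ y ] x ∈ A × y ∈ B × toℕ y ≡ toℕ x + suc c
  gap-surjective c<n with δ-surjective c<n
  ... | i , α , j , β , i<h3 , α<h1 , j<h4 , β<h2 , refl =
    eA i α , eB j β , ∈A⁺ i<h3 α<h1 , ∈B⁺ j<h4 β<h2 , toℕ-eB≡toℕ-eA+1+δ i<h3 α<h1 j<h4 β<h2

  A∩B≡∅ : ∀ {x} → x ∈ A → x ∈ B → ⊥
  A∩B≡∅ {x} x∈A x∈B = let _ , _ , gap = A×B-gap x∈A x∈B in m+1+n≢m (toℕ x) (sym gap)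

  ΔBA↭nonzero : Δ B A ↭ nonzero (suc n)
  ΔBA↭nonzero = ↭-nonzero unique nonzero⇐ nonzero⇒
    where
    unique : Unique (Δ B A)
    unique = cartesianProductWith⁺-on sub B-unique A-unique λ y∈B y′∈B x∈A x′∈A eq →
      let _ , _ , gap = A×B-gap x∈A y∈B ; _ , _ , gap′ = A×B-gap x′∈A y′∈B
          x≡x′ , y≡y′ = gap-injective x∈A x′∈A y∈B y′∈B gap gap′ (suc-injective
            (trans (sym (toℕ-sub-above gap)) (trans (cong toℕ eq) (toℕ-sub-above gap′))))
      in y≡y′ , x≡x′
    nonzero⇐ : ∀ {z} → z ∈ Δ B A → toℕ z ≢ 0
    nonzero⇐ z∈ with ∈-cartesianProductWith⁻ sub B A z∈
    ... | y , x , y∈B , x∈A , refl =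
      let _ , _ , gap = A×B-gap x∈A y∈B in 1+n≢0 ∘ trans (sym (toℕ-sub-above gap))
    nonzero⇒ : ∀ {z} → toℕ z ≢ 0 → z ∈ Δ B A
    nonzero⇒ z≢0 with toℕ≢0⇒≡suc z≢0
    ... | c , c<n , z≡1+c with gap-surjective c<n
    ... | x , y , x∈A , y∈B , gap =
      subst (_∈ Δ B A) (toℕ-injective (trans (toℕ-sub-above gap) (sym z≡1+c)))
        (∈-cartesianProductWith⁺ sub y∈B x∈A)

  ΔAB↭nonzero : Δ A B ↭ nonzero (suc n)
  ΔAB↭nonzero = ↭-nonzero unique nonzero⇐ nonzero⇒
    where
    unique : Unique (Δ A B)
    unique = cartesianProductWith⁺-on sub A-unique B-unique λ x∈A x′∈A y∈B y′∈B eq →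
      let _ , c<n , gap = A×B-gap x∈A y∈B ; _ , c′<n , gap′ = A×B-gap x′∈A y′∈B
      in gap-injective x∈A x′∈A y∈B y′∈B gap gap′ (∸-cancelˡ-≡ (<⇒≤ c<n) (<⇒≤ c′<n)
           (trans (sym (toℕ-sub-below gap)) (trans (cong toℕ eq) (toℕ-sub-below gap′))))
    nonzero⇐ : ∀ {z} → z ∈ Δ A B → toℕ z ≢ 0
    nonzero⇐ z∈ with ∈-cartesianProductWith⁻ sub A B z∈
    ... | x , y , x∈A , y∈B , refl =
      let _ , c<n , gap = A×B-gap x∈A y∈B in >⇒≢ (m<n⇒0<n∸m c<n) ∘ trans (sym (toℕ-sub-below gap))
    nonzero⇒ : ∀ {z} → toℕ z ≢ 0 → z ∈ Δ A B
    nonzero⇒ z≢0 with toℕ≢0⇒≡suc z≢0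
    ... | c , c<n , z≡1+c with gap-surjective (∸-suc-< c<n)
    ... | x , y , x∈A , y∈B , gap =
      subst (_∈ Δ A B) (toℕ-injective (trans (toℕ-sub-below gap) (trans (m∸[m∸n]≡n c<n) (sym z≡1+c))))
        (∈-cartesianProductWith⁺ sub x∈A y∈B)

theorem6p1 : (h1 h2 h3 h4 : ℕ) → .{{NonZero h1}} → .{{NonZero h2}} → .{{NonZero h3}} → .{{NonZero h4}} → IsGSEDF (suc (h1 * h2 * h3 * h4)) 2 (pair (setA h1 h2 h3 h4) (setB h1 h2 h3 h4)) (pair (h1 * h3) (h2 * h4)) (pair 1 1)
theorem6p1 h1 h2 h3 h4 = record
  { isSet    = λ { fz → A-unique ; (fs fz) → B-unique }
  ; disjoint = disjoint
  ; size     = λ { fz → length-A ; (fs fz) → length-B }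
  -- ΔOthers (pair A B) k and copies 1 S both compute to a single list followed by ++ []
  ; diffs    = λ { fz → ++⁺ʳ [] ΔAB↭nonzero ; (fs fz) → ++⁺ʳ [] ΔBA↭nonzero }
  }
  where
  open Construction h1 h2 h3 h4
  disjoint : ∀ k l → k ≢ l → ∀ x → x ∈ pair A B k → x ∈ pair A B l → ⊥
  disjoint fz      fz      k≢l _ _   _   = k≢l refl
  disjoint fz      (fs fz) _   _ x∈A x∈B = A∩B≡∅ x∈A x∈B
  disjoint (fs fz) fz      _   _ x∈B x∈A = A∩B≡∅ x∈A x∈B
  disjoint (fs fz) (fs fz) k≢l _ _   _   = k≢l refl
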